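{- Let $m\ge1$ be an integer. If $\delta_m\neq\delta_{m+1}$, then for every prime $p$, \[k_p=\begin{cases}k, & y_{m,k+1}<p\le y_{m,k}\ (k\ge1),\\ 0, & y_{m,1}<p.\end{cases}\] If instead $\delta_m=\delta_{m+1}$, where $(q_m,k_m)=(q,k)$ and $(q_{m+1},k_{m+1})=(q',k')$ with $q>q'$, then $k_q=k$ and $k_{q'}=k'-1$.
   Context: Consider all pairs $(q,k)$ with $q$ prime and $k\ge 1$ an integer, with value $z_{q,k}:=q+q^2+\cdots+q^k$. Enumerate these pairs as $(q_1,k_1),(q_2,k_2),\dots$ so that $z_i:=z_{q_i,k_i}$ is nondecreasing in $i$; if $z_{q,k}=z_{p,j}$ with $q>p$, then $(q,k)$ comes before $(p,j)$. Set $\delta_i:=\log(1+1/z_i)$. For $m\ge1$ let $E_m$ be the set of the first $m$ pairs; for each prime $p$ let $k_p$ be the largest $k$ with $(p,k)\in E_m$ ($k_p=0$ if none), and $n_m:=\prod_p p^{k_p}$. Define $y_{m,1}:=z_m$, and for $k\ge2$ let $y_{m,k}$ be the positive real solution of $y+y^2+\cdots+y^k=z_m$. -}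

module Defs where

open import Data.Nat using (ℕ; zero; suc; _+_; _*_; _∸_; _^_; _≤_; _<_)
open import Data.Nat.Properties using (_<?_; _≟_)
open import Data.Nat.Primality using (Prime; prime?)
open import Data.List using (List; map; upTo)
open import Data.Nat.ListAction using (sum)
open import Data.Product using (_×_; _,_)
open import Data.Sum using (_⊎_)
open import Relation.Binary.PropositionalEquality using (_≡_)
open import Relation.Nullary using (¬_; Dec; yes; no)
open import Relation.Nullary.Decidable using (_×-dec_; _⊎-dec_)

z : ℕ → ℕ → ℕ
z q zero    = 0
z q (suc k) = z q k + q ^ suc k

-- (p , j) comes strictly before (q , k) in the enumeration:
-- smaller value, or equal value and larger prime.
Before : ℕ → ℕ → ℕ → ℕ → Set
Before p j q k = z p j < z q k ⊎ (z p j ≡ z q k × q < p)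

before? : ∀ p j q k → Dec (Before p j q k)
before? p j q k = (z p j <? z q k) ⊎-dec ((z p j ≟ z q k) ×-dec (q <? p))

indicator : {A : Set} → Dec A → ℕ
indicator (yes _) = 1
indicator (no _)  = 0

-- rank q k = number of pairs (p , j), p prime, j ≥ 1, that come before (q , k).
-- Any such pair satisfies p ≤ z p j ≤ z q k and j ≤ z p j ≤ z q k,
-- so it suffices to count over p ≤ z q k and 1 ≤ j ≤ z q k.
rank : ℕ → ℕ → ℕ
rank q k =
  sum (map (λ p → sum (map (λ j → indicator (prime? p ×-dec before? p (suc j) q k))
                           (upTo (z q k))))
           (upTo (suc (z q k))))

-- (p , j) ∈ E_m : a valid pair among the first m pairs of the enumeration
-- (the i-th pair, 1-indexed, is the one with rank i - 1).
InE : ℕ → ℕ → ℕ → Set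
InE m p j = Prime p × 1 ≤ j × rank p j < m

IsKp : ℕ → ℕ → ℕ → Set
IsKp m p k = (k ≡ 0 ⊎ InE m p k) × (∀ j → k < j → ¬ InE m p j)

{-# OPTIONS --safe #-}
module Submission where

-- Before is a strict total order on the pairs (p , j) with p prime and j ≥ 1, and
-- rank is strictly monotone for it, so E_m consists exactly of the pairs that do not
-- come after the m-th pair (q , k). Hence k_p is the largest j with z p j ≤ z q k,
-- except when z p j = z q k with p < q, where (p , j) comes after (q , k). But the
-- (m+1)-st pair has the least value among the pairs after (q , k), so such a tie
-- forces z q k to be the value of the (m+1)-st pair as well.

open import Defs
open import Data.Nat using (ℕ; zero; suc; _+_; _∸_; _≤_; _<_; z≤n; s≤s; NonZero; _≤′_; ≤′-refl; ≤′-step)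
open import Data.Nat.Properties
open import Data.Nat.Primality using (Prime; prime?; prime⇒nonZero)
open import Data.Nat.ListAction using (sum)
open import Data.Nat.ListAction.Properties using (sum-++)
open import Data.List using ([]; _∷_; _++_; map; upTo)
open import Data.List.Properties using (map-++; upTo-∷ʳ)
open import Data.List.Membership.Propositional using (_∈_)
open import Data.List.Membership.Propositional.Properties using (∈-upTo⁺)
open import Data.List.Relation.Unary.Any using (here; there)
open import Data.Product using (_×_; _,_; proj₂)
open import Data.Sum using (_⊎_; inj₁; inj₂)
open import Data.Empty using (⊥-elim)
open import Function using (_∘_)
open import Relation.Binary using (tri<; tri≈; tri>)
open import Relation.Binary.PropositionalEquality
  using (_≡_; _≢_; refl; sym; trans; cong; subst; subst₂; module ≡-Reasoning)
open import Relation.Nullary using (¬_; Dec; yes; no)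
open import Relation.Nullary.Decidable using (_×-dec_)

mono-≤-from-suc : ∀ (f : ℕ → ℕ) → (∀ n → f n ≤ f (suc n)) → ∀ {m n} → m ≤ n → f m ≤ f n
mono-≤-from-suc f step = mono′ ∘ ≤⇒≤′
  where
  mono′ : ∀ {m n} → m ≤′ n → f m ≤ f n
  mono′ ≤′-refl        = ≤-refl
  mono′ (≤′-step m≤′n) = ≤-trans (mono′ m≤′n) (step _)

z-<-suc : ∀ p .{{_ : NonZero p}} j → z p j < z p (suc j)
z-<-suc p j = m<m+n (z p j) (m^n>0 p (suc j))

z-mono-≤ : ∀ p {j j′} → j ≤ j′ → z p j ≤ z p j′
z-mono-≤ p = mono-≤-from-suc (z p) (λ j → m≤m+n (z p j) _)

z-mono-< : ∀ p .{{_ : NonZero p}} {j j′} → j < j′ → z p j < z p j′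
z-mono-< p {j} j<j′ = <-≤-trans (z-<-suc p j) (z-mono-≤ p j<j′)

z-injective : ∀ p .{{_ : NonZero p}} {j j′} → z p j ≡ z p j′ → j ≡ j′
z-injective p e = ≤-antisym (≮⇒≥ (λ j′<j → <-irrefl (sym e) (z-mono-< p j′<j)))
                            (≮⇒≥ (λ j<j′ → <-irrefl e (z-mono-< p j<j′)))

j≤z : ∀ p .{{_ : NonZero p}} j → j ≤ z p j
j≤z p zero    = z≤n
j≤z p (suc j) = <-≤-trans (s≤s (j≤z p j)) (z-<-suc p j)

p≤z : ∀ p {j} → 1 ≤ j → p ≤ z p j
p≤z p 1≤j = ≤-trans (≤-reflexive (sym (*-identityʳ p))) (z-mono-≤ p 1≤j)

Before-irrefl : ∀ p j → ¬ Before p j p j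
Before-irrefl _ _ (inj₁ z<z)       = <-irrefl refl z<z
Before-irrefl _ _ (inj₂ (_ , p<p)) = <-irrefl refl p<p

Before-trans : ∀ {p j q k r l} → Before p j q k → Before q k r l → Before p j r l
Before-trans (inj₁ a)       (inj₁ b)        = inj₁ (<-trans a b)
Before-trans (inj₁ a)       (inj₂ (e , _))  = inj₁ (<-≤-trans a (≤-reflexive e))
Before-trans (inj₂ (e , _)) (inj₁ b)        = inj₁ (≤-<-trans (≤-reflexive e) b)
Before-trans (inj₂ (e , a)) (inj₂ (e′ , b)) = inj₂ (trans e e′ , <-trans b a)

Before⇒z≤ : ∀ {p j q k} → Before p j q k → z p j ≤ z q k
Before⇒z≤ (inj₁ z<z)     = <⇒≤ z<z
Before⇒z≤ (inj₂ (e , _)) = ≤-reflexive e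

¬Before⇒z≥ : ∀ {p j q k} → ¬ Before p j q k → z q k ≤ z p j
¬Before⇒z≥ ¬b = ≮⇒≥ (¬b ∘ inj₁)

z≤∧prime>⇒Before : ∀ {p j q k} → z p j ≤ z q k → q < p → Before p j q k
z≤∧prime>⇒Before z≤z q<p with m≤n⇒m<n∨m≡n z≤z
... | inj₁ z<z = inj₁ z<z
... | inj₂ z≡z = inj₂ (z≡z , q<p)

Before-cmp : ∀ p .{{_ : NonZero p}} j q k → Before p j q k ⊎ (p ≡ q × j ≡ k) ⊎ Before q k p j
Before-cmp p j q k with <-cmp (z p j) (z q k) | <-cmp p q
... | tri< z<z _ _ | _             = inj₁ (inj₁ z<z)
... | tri> _ _ z>z | _             = inj₂ (inj₂ (inj₁ z>z))
... | tri≈ _ e _   | tri< p<q _ _  = inj₂ (inj₂ (inj₂ (sym e , p<q)))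
... | tri≈ _ e _   | tri> _ _ p>q  = inj₁ (inj₂ (e , p>q))
... | tri≈ _ e _   | tri≈ _ refl _ = inj₂ (inj₁ (refl , z-injective p e))

sum-map-mono-≤ : ∀ {A : Set} {f g : A → ℕ} → (∀ x → f x ≤ g x) →
                 ∀ xs → sum (map f xs) ≤ sum (map g xs)
sum-map-mono-≤ f≤g []       = z≤n
sum-map-mono-≤ f≤g (x ∷ xs) = +-mono-≤ (f≤g x) (sum-map-mono-≤ f≤g xs)

sum-map-mono-< : ∀ {A : Set} {f g : A → ℕ} → (∀ x → f x ≤ g x) →
                 ∀ {x xs} → x ∈ xs → f x < g x → sum (map f xs) < sum (map g xs)
sum-map-mono-< f≤g {xs = _ ∷ xs} (here refl) fx<gx = +-mono-<-≤ fx<gx (sum-map-mono-≤ f≤g xs)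
sum-map-mono-< f≤g {xs = y ∷ _}  (there x∈xs) fx<gx = +-mono-≤-< (f≤g y) (sum-map-mono-< f≤g x∈xs fx<gx)

sum-map-upTo-suc : ∀ (f : ℕ → ℕ) n → sum (map f (upTo (suc n))) ≡ sum (map f (upTo n)) + f n
sum-map-upTo-suc f n = begin
  sum (map f (upTo (suc n)))        ≡⟨ cong (sum ∘ map f) (upTo-∷ʳ n) ⟨
  sum (map f (upTo n ++ n ∷ []))    ≡⟨ cong sum (map-++ f (upTo n) (n ∷ [])) ⟩
  sum (map f (upTo n) ++ f n ∷ [])  ≡⟨ sum-++ (map f (upTo n)) (f n ∷ []) ⟩
  sum (map f (upTo n)) + (f n + 0)  ≡⟨ cong (sum (map f (upTo n)) +_) (+-identityʳ (f n)) ⟩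
  sum (map f (upTo n)) + f n        ∎
  where open ≡-Reasoning

sum-map-upTo-mono : ∀ (f : ℕ → ℕ) {n n′} → n ≤ n′ → sum (map f (upTo n)) ≤ sum (map f (upTo n′))
sum-map-upTo-mono f = mono-≤-from-suc (λ n → sum (map f (upTo n)))
  (λ n → ≤-trans (m≤m+n _ (f n)) (≤-reflexive (sym (sum-map-upTo-suc f n))))

indicator-mono : ∀ {A B : Set} (a? : Dec A) (b? : Dec B) → (A → B) → indicator a? ≤ indicator b?
indicator-mono (yes _) (yes _) _   = ≤-refl
indicator-mono (yes a) (no ¬b) A→B = ⊥-elim (¬b (A→B a))
indicator-mono (no _)  _       _   = z≤n

indicator-< : ∀ {A B : Set} (a? : Dec A) (b? : Dec B) → ¬ A → B → indicator a? < indicator b?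
indicator-< (yes a) _       ¬a _ = ⊥-elim (¬a a)
indicator-< (no _)  (yes _) _  _ = s≤s z≤n
indicator-< (no _)  (no ¬b) _  b = ⊥-elim (¬b b)

precedes : ℕ → ℕ → ℕ → ℕ → ℕ
precedes q k p j = indicator (prime? p ×-dec before? p (suc j) q k)

-- rank q k unfolds to rankBelow (z q k) q k.
rankBelow : ℕ → ℕ → ℕ → ℕ
rankBelow N q k = sum (map (λ p → sum (map (precedes q k p) (upTo N))) (upTo (suc N)))

rankBelow-monoˡ : ∀ q k {N N′} → N ≤ N′ → rankBelow N q k ≤ rankBelow N′ q k
rankBelow-monoˡ q k {N} N≤N′ =
  ≤-trans (sum-map-mono-≤ (λ p → sum-map-upTo-mono (precedes q k p) N≤N′) (upTo (suc N)))
          (sum-map-upTo-mono _ (s≤s N≤N′))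

precedes-mono : ∀ p j q k → Before p j q k → ∀ a i → precedes p j a i ≤ precedes q k a i
precedes-mono p j q k b a i =
  indicator-mono (prime? a ×-dec before? a (suc i) p j) (prime? a ×-dec before? a (suc i) q k)
                 (λ (a-prime , a≺p) → a-prime , Before-trans {a} {suc i} {p} {j} {q} {k} a≺p b)

rankBelow-mono-< : ∀ {p j q k N} → Prime p → z p (suc j) ≤ N → Before p (suc j) q k →
                   rankBelow N p (suc j) < rankBelow N q k
rankBelow-mono-< {p} {j} {q} {k} {N} pp z≤N b =
  sum-map-mono-< (λ a → sum-map-mono-≤ (precedes-mono p (suc j) q k b a) (upTo N))
                 (∈-upTo⁺ (s≤s (≤-trans (p≤z p {suc j} (s≤s z≤n)) z≤N)))
    (sum-map-mono-< (precedes-mono p (suc j) q k b p)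
                    (∈-upTo⁺ (≤-trans (j≤z p {{prime⇒nonZero pp}} (suc j)) z≤N))
                    (indicator-< (prime? p ×-dec before? p (suc j) p (suc j))
                                 (prime? p ×-dec before? p (suc j) q k)
                                 (Before-irrefl p (suc j) ∘ proj₂) (pp , b)))

rank-mono-< : ∀ {p j q k} → Prime p → 1 ≤ j → Before p j q k → rank p j < rank q k
rank-mono-< {p} {suc j} {q} {k} pp _ b =
  ≤-<-trans (rankBelow-monoˡ p (suc j) z≤z) (rankBelow-mono-< {p} {j} {q} {k} pp z≤z b)
  where
  z≤z : z p (suc j) ≤ z q k
  z≤z = Before⇒z≤ {p} {suc j} {q} {k} b

rank-<⇒Before : ∀ {p j q k} → Prime p → Prime q → 1 ≤ k → rank p j < rank q k → Before p j q k
rank-<⇒Before {p} {j} {q} {k} pp pq 1≤k r<r with Before-cmp p {{prime⇒nonZero pp}} j q k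
... | inj₁ p≺q                  = p≺q
... | inj₂ (inj₁ (refl , refl)) = ⊥-elim (<-irrefl refl r<r)
... | inj₂ (inj₂ q≺p)           = ⊥-elim (<-asym r<r (rank-mono-< {q} {k} {p} {j} pq 1≤k q≺p))

Before⇒InE-rank : ∀ {p j q k} → Prime p → 1 ≤ j → Before p j q k → InE (rank q k) p j
Before⇒InE-rank {q = q} {k} pp 1≤j b = pp , 1≤j , rank-mono-< {q = q} {k} pp 1≤j b

InE-before-next-power : ∀ {p} j → Prime p → j ≡ 0 ⊎ InE (rank p (suc j)) p j
InE-before-next-power zero    _  = inj₁ refl
InE-before-next-power {p} (suc j) pp =
  inj₂ (Before⇒InE-rank {p} {suc j} {p} {suc (suc j)} pp (s≤s z≤n)
                        (inj₁ (z-<-suc p {{prime⇒nonZero pp}} (suc j))))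

module LastPair {q k r : ℕ} (q-prime : Prime q) (1≤k : 1 ≤ k) (rank≡r : rank q k ≡ r) where

  after⇒∉E : ∀ {p j} → Before q k p j → ¬ InE (suc r) p j
  after⇒∉E {p} {j} q≺p (_ , _ , rank<) =
    <⇒≱ (subst (_< rank p j) rank≡r (rank-mono-< {q} {k} {p} {j} q-prime 1≤k q≺p))
        (m<1+n⇒m≤n rank<)

  ¬after⇒∈E : ∀ {p j} → Prime p → 1 ≤ j → ¬ Before q k p j → InE (suc r) p j
  ¬after⇒∈E {p} {j} pp 1≤j ¬q≺p =
    pp , 1≤j , s≤s (subst (rank p j ≤_) rank≡r
                          (≮⇒≥ (¬q≺p ∘ rank-<⇒Before {q} {k} {p} {j} q-prime pp 1≤j)))

  after⇒z-next≤ : ∀ {q′ k′ p j} → rank q′ k′ ≡ suc r → Prime p → 1 ≤ j →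
                  Before q k p j → z q′ k′ ≤ z p j
  after⇒z-next≤ {q′} {k′} {p} {j} rank′≡ pp 1≤j q≺p =
    ¬Before⇒z≥ {p} {j} {q′} {k′} λ p≺q′ →
      after⇒∉E {p} {j} q≺p
        (subst (λ m → InE m p j) rank′≡ (Before⇒InE-rank {p} {j} {q′} {k′} pp 1≤j p≺q′))

  IsKp-intro : ∀ {p j} → j ≡ 0 ⊎ InE (suc r) p j → (∀ j′ → j < j′ → Before q k p j′) →
               IsKp (suc r) p j
  IsKp-intro {p} j∈E later = j∈E , λ j′ j<j′ → after⇒∉E {p} {j′} (later j′ j<j′)

  IsKp-last : IsKp (suc r) q k
  IsKp-last = IsKp-intro (inj₂ (q-prime , 1≤k , s≤s (≤-reflexive rank≡r)))
                         (λ j k<j → inj₁ (z-mono-< q {{prime⇒nonZero q-prime}} k<j))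

  IsKp-interval : ∀ {p j} → Prime p → 1 ≤ j → z q k < z p (suc j) → ¬ Before q k p j →
                  IsKp (suc r) p j
  IsKp-interval {p} pp 1≤j z< ¬q≺p =
    IsKp-intro (inj₂ (¬after⇒∈E pp 1≤j ¬q≺p)) (λ j′ j<j′ → inj₁ (<-≤-trans z< (z-mono-≤ p j<j′)))

  IsKp-beyond : ∀ {p} → Prime p → z q k < p → IsKp (suc r) p 0
  IsKp-beyond {p} pp z<p = IsKp-intro (inj₁ refl) (λ j 0<j → inj₁ (<-≤-trans z<p (p≤z p 0<j)))

  IsKp-tied-next : ∀ {q′ k′} → Prime q′ → rank q′ (suc k′) ≡ suc r → z q k ≡ z q′ (suc k′) →
                   q′ < q → IsKp (suc r) q′ k′
  IsKp-tied-next {q′} {k′} q′-prime rank′≡ z≡ q′<q =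
    IsKp-intro (subst (λ m → k′ ≡ 0 ⊎ InE m q′ k′) rank′≡ (InE-before-next-power {q′} k′ q′-prime))
               λ j k′<j → z≤∧prime>⇒Before {q} {k} {q′} {j}
                            (subst (_≤ z q′ j) (sym z≡) (z-mono-≤ q′ k′<j)) q′<q

theorem2 : (m : ℕ) → 1 ≤ m →
    (q k q′ k′ : ℕ) → Prime q → 1 ≤ k → Prime q′ → 1 ≤ k′ →
    rank q k ≡ m ∸ 1 → rank q′ k′ ≡ m →
    (z q k ≢ z q′ k′ →
      (p : ℕ) → Prime p →
        ((j : ℕ) → 1 ≤ j → z p j ≤ z q k → z q k < z p (suc j) → IsKp m p j)
        × (z q k < p → IsKp m p 0))
    × (z q k ≡ z q′ k′ → q′ < q → IsKp m q k × IsKp m q′ (k′ ∸ 1))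
theorem2 (suc r) (s≤s z≤n) q k q′ (suc k′) q-prime 1≤k q′-prime (s≤s z≤n) rank≡r rank′≡ =
  (λ z≢ p pp → (λ j 1≤j z≤ z< → IsKp-interval pp 1≤j z< (untied⇒¬after z≢ pp 1≤j z≤)) , IsKp-beyond pp)
  , λ z≡ q′<q → IsKp-last , IsKp-tied-next q′-prime rank′≡ z≡ q′<q
  where
  open LastPair q-prime 1≤k rank≡r

  q≺q′ : Before q k q′ (suc k′)
  q≺q′ = rank-<⇒Before {q} {k} {q′} {suc k′} q-prime q′-prime (s≤s z≤n)
           (subst₂ _<_ (sym rank≡r) (sym rank′≡) (n<1+n r))

  untied⇒¬after : z q k ≢ z q′ (suc k′) → ∀ {p j} → Prime p → 1 ≤ j → z p j ≤ z q k → ¬ Before q k p j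
  untied⇒¬after z≢ {p} {j} pp 1≤j z≤ q≺p =
    z≢ (≤-antisym (Before⇒z≤ {q} {k} {q′} {suc k′} q≺q′)
                  (≤-trans (after⇒z-next≤ {q′} {suc k′} {p} {j} rank′≡ pp 1≤j q≺p) z≤))
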